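{- Let $X,Y$ be lower Eulerian posets, $\sigma:X\to Y$ a strong formal subdivision with associated poset $\Gamma$, $r_\Gamma\in I(\Gamma)$ a weak rank function and $\kappa_\Gamma\in\mathcal{I}(\Gamma)\cap U(\Gamma)$ multiplicative and rank alternating (as in the context). Then \[\kappa_\Gamma|_{X/Y}=\kappa_\Gamma|_{(X/Y)^\circ}\cdot\kappa_\Gamma=-\kappa_\Gamma\cdot(\kappa_\Gamma|_{(X/Y)^\circ})^{\mathrm{rev}}.\]
   Context: All posets are finite. $I(B)$ is the set of functions $p$ from closed intervals $[z,z']$ of $B$ to $\mathbb{Z}[t]$, a ring under pointwise sum and product $(p\cdot p')(z,z')=\sum_{z\le z''\le z'}p(z,z'')p'(z'',z')$. A weak rank function is $r_B\in I(B)$ with nonnegative integer values, positive for $z<z'$, additive along chains; $\mathcal{I}(B)=\{p:\deg p(z,z')\le r_B(z,z')\}$, $p^{\mathrm{rev}}(z,z';t)=t^{r_B(z,z')}p(z,z';t^{ -1})$, $U(B)=\{p:p(z,z)=1\}$. A poset is lower Eulerian if it has a unique minimal element, a rank function $\rho_B$ ($\rho_B(z')=\rho_B(z)+1$ when $z'$ covers $z$), and $\sum_{z\le z''\le z'}(-1)^{\rho_B(z'')}=0$ for $z<z'$; $\rho_B(z,z')=\rho_B(z')-\rho_B(z)$. $p$ is rank alternating if $p^{\mathrm{rev}}(z,z')=(-1)^{\rho_B(z,z')}p(z,z')$, multiplicative if $p(z,z')=p(z,z'')p(z'',z')$ for $z\le z''\le z'$. Setting: $X,Y$ lower Eulerian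 with rank functions $\rho_X,\rho_Y$; $\sigma:X\to Y$ a strong formal subdivision: order-preserving; $\rho_X(x)\le\rho_Y(\sigma(x))$; surjective, and for $x\in X,y\in Y$ with $\sigma(x)\le y$ there is $x'\ge x$ with $\rho_X(x')=\rho_Y(y)$, $\sigma(x')=y$; and $\sum_{x\le x'\in X,\sigma(x')=y}(-1)^{\rho_Y(y)-\rho_X(x')}=1$ for all such $x,y$. $\Gamma$ is the poset on $X\sqcup Y$ with the orders of $X,Y$ and $x\le y$ ($x\in X,y\in Y$) iff $\sigma(x)\le y$; it is lower Eulerian with rank function $\rho_X$ on $X$ and $\rho_Y+1$ on $Y$. For $p\in\mathcal{I}(\Gamma)$, $p|_{X/Y}$ (resp. $p|_{(X/Y)^\circ}$) agrees with $p$ on intervals $[z,z']$ with $z\in X,z'\in Y$ (resp. $z\in X$, $z'=\sigma(z)$) and is $0$ on all other intervals. -}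

module Defs where

open import Data.Nat as ℕ using (ℕ; zero; suc; _∸_)
open import Data.Integer as ℤ using (ℤ; +_; -_)
open import Data.Fin using (Fin; splitAt)
import Data.Fin.Properties as FinP
open import Data.Sum using (_⊎_; inj₁; inj₂)
open import Data.Product using (Σ; ∃; _×_; _,_)
open import Data.Empty using (⊥)
open import Data.Unit using (⊤; tt)
open import Relation.Binary using (Decidable; IsPartialOrder)
open import Relation.Binary.PropositionalEquality using (_≡_)
open import Relation.Nullary using (¬_; yes; no; Dec)

sumFin : (n : ℕ) → (Fin n → ℤ) → ℤ
sumFin zero    f = + 0
sumFin (suc n) f = f Fin.zero ℤ.+ sumFin n (λ i → f (Fin.suc i))

sumUpTo : ℕ → (ℕ → ℤ) → ℤ
sumUpTo zero    f = f 0
sumUpTo (suc k) f = sumUpTo k f ℤ.+ f (suc k)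

sign : ℕ → ℤ
sign zero    = + 1
sign (suc n) = - sign n

-- Z[t]: a polynomial is given by its coefficient sequence (coefficient of t^k).
-- All polynomials occurring in the statement have bounded degree (membership
-- in 𝓘(Γ) is an explicit hypothesis).

Poly : Set
Poly = ℕ → ℤ

_≈P_ : Poly → Poly → Set
p ≈P q = ∀ k → p k ≡ q k

0P : Poly
0P _ = + 0

1P : Poly
1P zero    = + 1
1P (suc _) = + 0

_+P_ : Poly → Poly → Poly
(p +P q) k = p k ℤ.+ q k

_*P_ : Poly → Poly → Poly
(p *P q) k = sumUpTo k (λ i → p i ℤ.* q (k ∸ i))

-P_ : Poly → Poly
(-P p) k = - p k

scaleP : ℤ → Poly → Poly
scaleP c p k = c ℤ.* p k

sumP : (n : ℕ) → (Fin n → Poly) → Poly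
sumP n f k = sumFin n (λ i → f i k)

record FinOrd : Set₁ where
  field
    size : ℕ
    _≤_  : Fin size → Fin size → Set
    _≤?_ : Decidable _≤_

module Incidence (B : FinOrd) where
  open FinOrd B

  Elt : Set
  Elt = Fin size

  gate : Elt → Elt → Elt → ℤ → ℤ
  gate z w z' x with z ≤? w | w ≤? z'
  ... | yes _ | yes _ = x
  ... | _     | _     = + 0

  gateP : Elt → Elt → Elt → Poly → Poly
  gateP z w z' p k = gate z w z' (p k)

  -- elements of I(B): functions on intervals (values off intervals are irrelevant)
  IFun : Set
  IFun = Elt → Elt → Poly

  _≈I_ : IFun → IFun → Set
  p ≈I q = ∀ z z' → z ≤ z' → p z z' ≈P q z z'

  _·_ : IFun → IFun → IFun
  (p · q) z z' = sumP size (λ w → gateP z w z' (p z w *P q w z'))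

  -I_ : IFun → IFun
  (-I p) z z' = -P (p z z')

  _<B_ : Elt → Elt → Set
  z <B z' = z ≤ z' × ¬ (z ≡ z')

  IsWeakRank : (Elt → Elt → ℕ) → Set
  IsWeakRank r =
    (∀ z z' → z <B z' → 0 ℕ.< r z z') ×
    (∀ z w z' → z ≤ w → w ≤ z' → r z z' ≡ r z w ℕ.+ r w z')

  InCalI : (Elt → Elt → ℕ) → IFun → Set
  InCalI r p = ∀ z z' → z ≤ z' → ∀ k → r z z' ℕ.< k → p z z' k ≡ + 0

  -- p^rev(z,z';t) = t^{r(z,z')} p(z,z';t^{-1})
  rev : (Elt → Elt → ℕ) → IFun → IFun
  rev r p z z' k with k ℕ.≤? r z z'
  ... | yes _ = p z z' (r z z' ∸ k)
  ... | no  _ = + 0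

  InU : IFun → Set
  InU p = ∀ z → p z z ≈P 1P

  Multiplicative : IFun → Set
  Multiplicative p = ∀ z w z' → z ≤ w → w ≤ z' → p z z' ≈P (p z w *P p w z')

  RankAlternating : (Elt → Elt → ℕ) → (Elt → ℕ) → IFun → Set
  RankAlternating r ρ p =
    ∀ z z' → z ≤ z' → rev r p z z' ≈P scaleP (sign (ρ z' ∸ ρ z)) (p z z')

  Minimal : Elt → Set
  Minimal m = ∀ z → z ≤ m → z ≡ m

  Covers : Elt → Elt → Set
  Covers z z' = z <B z' × (∀ w → z ≤ w → w ≤ z' → w ≡ z ⊎ w ≡ z')

record LowerEulerian (B : FinOrd) (ρ : Fin (FinOrd.size B) → ℕ) : Set where
  open FinOrd B
  open Incidence B
  field
    isPartialOrder : IsPartialOrder _≡_ _≤_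
    uniqueMinimal  : ∃ λ m → Minimal m × (∀ m' → Minimal m' → m' ≡ m)
    rank           : ∀ z z' → Covers z z' → ρ z' ≡ suc (ρ z)
    eulerian       : ∀ z z' → z <B z' →
                     sumFin size (λ w → gate z w z' (sign (ρ w))) ≡ + 0

module Subdivision (X Y : FinOrd) where
  private
    module X = FinOrd X
    module Y = FinOrd Y

  fiberGate : (Fin X.size → Fin Y.size) → Fin X.size → Fin Y.size →
              Fin X.size → ℤ → ℤ
  fiberGate σ x y x' v with x X.≤? x' | σ x' FinP.≟ y
  ... | yes _ | yes _ = v
  ... | _     | _     = + 0

  record StrongFormalSubdivision (ρX : Fin X.size → ℕ) (ρY : Fin Y.size → ℕ)
                                 (σ : Fin X.size → Fin Y.size) : Set where
    field
      orderPreserving : ∀ x x' → x X.≤ x' → σ x Y.≤ σ x'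
      rankIneq        : ∀ x → ρX x ℕ.≤ ρY (σ x)
      surjective      : ∀ y → ∃ λ x → σ x ≡ y
      lifting         : ∀ x y → σ x Y.≤ y →
                        ∃ λ x' → x X.≤ x' × ρX x' ≡ ρY y × σ x' ≡ y
      fiberSum        : ∀ x y → σ x Y.≤ y →
                        sumFin X.size (λ x' → fiberGate σ x y x' (sign (ρY y ∸ ρX x')))
                          ≡ + 1

  -- the poset Γ on X ⊔ Y, carrier Fin (|X| + |Y|) split via splitAt
  ΓRel : (σ : Fin X.size → Fin Y.size) →
         Fin X.size ⊎ Fin Y.size → Fin X.size ⊎ Fin Y.size → Set
  ΓRel σ (inj₁ x) (inj₁ x') = x X.≤ x'
  ΓRel σ (inj₁ x) (inj₂ y)  = σ x Y.≤ y
  ΓRel σ (inj₂ y) (inj₁ x)  = ⊥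
  ΓRel σ (inj₂ y) (inj₂ y') = y Y.≤ y'

  ΓRel? : (σ : Fin X.size → Fin Y.size) → ∀ a b → Dec (ΓRel σ a b)
  ΓRel? σ (inj₁ x) (inj₁ x') = x X.≤? x'
  ΓRel? σ (inj₁ x) (inj₂ y)  = σ x Y.≤? y
  ΓRel? σ (inj₂ y) (inj₁ x)  = no (λ ())
  ΓRel? σ (inj₂ y) (inj₂ y') = y Y.≤? y'

  Γ : (σ : Fin X.size → Fin Y.size) → FinOrd
  Γ σ = record
    { size = X.size ℕ.+ Y.size
    ; _≤_  = λ a b → ΓRel σ (splitAt X.size a) (splitAt X.size b)
    ; _≤?_ = λ a b → ΓRel? σ (splitAt X.size a) (splitAt X.size b)
    }

  ρΓ : (Fin X.size → ℕ) → (Fin Y.size → ℕ) → Fin (X.size ℕ.+ Y.size) → ℕ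
  ρΓ ρX ρY a with splitAt X.size a
  ... | inj₁ x = ρX x
  ... | inj₂ y = suc (ρY y)

  resXY : (Fin (X.size ℕ.+ Y.size) → Fin (X.size ℕ.+ Y.size) → Poly) →
          Fin (X.size ℕ.+ Y.size) → Fin (X.size ℕ.+ Y.size) → Poly
  resXY p a b with splitAt X.size a | splitAt X.size b
  ... | inj₁ _ | inj₂ _ = p a b
  ... | _      | _      = 0P

  resXY° : (σ : Fin X.size → Fin Y.size) →
           (Fin (X.size ℕ.+ Y.size) → Fin (X.size ℕ.+ Y.size) → Poly) →
           Fin (X.size ℕ.+ Y.size) → Fin (X.size ℕ.+ Y.size) → Poly
  resXY° σ p a b with splitAt X.size a | splitAt X.size b
  ... | inj₁ x | inj₂ y with σ x FinP.≟ y
  ...   | yes _ = p a b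
  ...   | no  _ = 0P
  resXY° σ p a b | _ | _ = 0P

{-# OPTIONS --safe #-}
-- On an interval [x, y] of Γ with x ∈ X and y ∈ Y, the only nonzero term of
-- (κ|° · κ)(x, y) sits at σ x, where it is κ(x, σ x) κ(σ x, y) = κ(x, y) by
-- multiplicativity. The nonzero terms of (κ · (κ|°)^rev)(x, y) sit at the
-- x' ≥ x with σ x' = y; rank alternation turns each of them into
-- (-1)^(ρY y + 1 - ρX x') κ(x, y), and the fiber-sum axiom of σ adds these
-- signs up to -1. On every other interval both sides vanish, because X is a
-- down-set and Y an up-set of Γ.
module Submission where

open import Defs
open import Data.Nat using (ℕ; zero; suc; _∸_)
import Data.Nat as ℕ
import Data.Nat.Properties as ℕP
open import Data.Integer as ℤ using (ℤ; +_; -_)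
import Data.Integer.Properties as ℤP
open import Data.Fin using (Fin; splitAt; _↑ˡ_; _↑ʳ_)
import Data.Fin.Properties as FinP
open import Data.Sum using (inj₁; inj₂)
open import Data.Sum.Properties using (inj₁-injective; inj₂-injective)
open import Data.Product using (_×_; ∃; ∃₂; _,_)
open import Data.Empty using (⊥-elim)
open import Function using (_∘_)
open import Relation.Nullary using (¬_; yes; no; Dec)
open import Relation.Binary using (Reflexive; IsPartialOrder)
open import Relation.Binary.PropositionalEquality
import Relation.Binary.Reasoning.Setoid as SetoidReasoning

module PolyReasoning = SetoidReasoning (ℕ →-setoid ℤ)

inj₁≢inj₂ : ∀ {a b} {A : Set a} {B : Set b} {x : A} {y : B} → inj₁ x ≢ inj₂ y
inj₁≢inj₂ ()

sign-suc-∸ : ∀ {m n} → m ℕ.≤ n → sign (suc n ∸ m) ≡ - sign (n ∸ m)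
sign-suc-∸ m≤n = cong sign (ℕP.+-∸-assoc 1 m≤n)

sumUpTo-cong : ∀ k {f g : ℕ → ℤ} → (∀ i → f i ≡ g i) → sumUpTo k f ≡ sumUpTo k g
sumUpTo-cong zero    f≗g = f≗g 0
sumUpTo-cong (suc k) f≗g = cong₂ ℤ._+_ (sumUpTo-cong k f≗g) (f≗g (suc k))

sumUpTo-zero : ∀ k {f : ℕ → ℤ} → (∀ i → f i ≡ + 0) → sumUpTo k f ≡ + 0
sumUpTo-zero zero    f≗0 = f≗0 0
sumUpTo-zero (suc k) f≗0 = cong₂ ℤ._+_ (sumUpTo-zero k f≗0) (f≗0 (suc k))

sumUpTo-*ˡ : ∀ k c (f : ℕ → ℤ) → sumUpTo k (λ i → c ℤ.* f i) ≡ c ℤ.* sumUpTo k f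
sumUpTo-*ˡ zero    c f = refl
sumUpTo-*ˡ (suc k) c f = trans (cong (ℤ._+ c ℤ.* f (suc k)) (sumUpTo-*ˡ k c f))
                               (sym (ℤP.*-distribˡ-+ c (sumUpTo k f) (f (suc k))))

sumFin-cong : ∀ n {f g : Fin n → ℤ} → (∀ i → f i ≡ g i) → sumFin n f ≡ sumFin n g
sumFin-cong zero    f≗g = refl
sumFin-cong (suc n) f≗g = cong₂ ℤ._+_ (f≗g Fin.zero) (sumFin-cong n (f≗g ∘ Fin.suc))

sumFin-zero : ∀ n {f : Fin n → ℤ} → (∀ i → f i ≡ + 0) → sumFin n f ≡ + 0
sumFin-zero zero    f≗0 = refl
sumFin-zero (suc n) f≗0 = cong₂ ℤ._+_ (f≗0 Fin.zero) (sumFin-zero n (f≗0 ∘ Fin.suc))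

sumFin-supported-at : ∀ n {f : Fin n → ℤ} i₀ → (∀ i → i ≢ i₀ → f i ≡ + 0) →
                      sumFin n f ≡ f i₀
sumFin-supported-at (suc n) {f} Fin.zero f≗0 =
  trans (cong (ℤ._+_ (f Fin.zero)) (sumFin-zero n (λ i → f≗0 (Fin.suc i) λ ())))
        (ℤP.+-identityʳ (f Fin.zero))
sumFin-supported-at (suc n) {f} (Fin.suc i₀) f≗0 =
  trans (cong₂ ℤ._+_ (f≗0 Fin.zero λ ())
                     (sumFin-supported-at n i₀ λ i i≢i₀ →
                        f≗0 (Fin.suc i) (i≢i₀ ∘ FinP.suc-injective)))
        (ℤP.+-identityˡ (f (Fin.suc i₀)))

sumFin-split : ∀ m n (f : Fin (m ℕ.+ n) → ℤ) →
               sumFin (m ℕ.+ n) f ≡ sumFin m (f ∘ (_↑ˡ n)) ℤ.+ sumFin n (f ∘ (m ↑ʳ_))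
sumFin-split zero    n f = sym (ℤP.+-identityˡ (sumFin n f))
sumFin-split (suc m) n f = trans (cong (ℤ._+_ (f Fin.zero)) (sumFin-split m n (f ∘ Fin.suc)))
                                 (sym (ℤP.+-assoc (f Fin.zero) _ _))

sumFin-*ʳ : ∀ n (f : Fin n → ℤ) c → sumFin n (λ i → f i ℤ.* c) ≡ sumFin n f ℤ.* c
sumFin-*ʳ zero    f c = refl
sumFin-*ʳ (suc n) f c = trans (cong (ℤ._+_ (f Fin.zero ℤ.* c)) (sumFin-*ʳ n (f ∘ Fin.suc) c))
                              (sym (ℤP.*-distribʳ-+ c (f Fin.zero) _))

*P-congˡ : ∀ {p p'} q → p ≈P p' → (p *P q) ≈P (p' *P q)
*P-congˡ q p≈p' k = sumUpTo-cong k (λ i → cong (ℤ._* q (k ∸ i)) (p≈p' i))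

*P-congʳ : ∀ p {q q'} → q ≈P q' → (p *P q) ≈P (p *P q')
*P-congʳ p q≈q' k = sumUpTo-cong k (λ i → cong (p i ℤ.*_) (q≈q' (k ∸ i)))

*P-zeroˡ : ∀ {p} q → p ≈P 0P → (p *P q) ≈P 0P
*P-zeroˡ q p≈0 k = sumUpTo-zero k (λ i → cong (ℤ._* q (k ∸ i)) (p≈0 i))

*P-zeroʳ : ∀ p {q} → q ≈P 0P → (p *P q) ≈P 0P
*P-zeroʳ p q≈0 k =
  sumUpTo-zero k (λ i → trans (cong (p i ℤ.*_) (q≈0 (k ∸ i))) (ℤP.*-zeroʳ (p i)))

*P-scaleʳ : ∀ p q c → (p *P scaleP c q) ≈P scaleP c (p *P q)
*P-scaleʳ p q c k = trans (sumUpTo-cong k (λ i → swap (p i) (q (k ∸ i))))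
                          (sumUpTo-*ˡ k c (λ i → p i ℤ.* q (k ∸ i)))
  where
  swap : ∀ a b → a ℤ.* (c ℤ.* b) ≡ c ℤ.* (a ℤ.* b)
  swap a b = trans (sym (ℤP.*-assoc a c b))
                   (trans (cong (ℤ._* b) (ℤP.*-comm a c)) (ℤP.*-assoc c a b))

module IncidenceProperties (B : FinOrd) where
  open FinOrd B
  open Incidence B

  gate-inside : ∀ {z w z'} v → z ≤ w → w ≤ z' → gate z w z' v ≡ v
  gate-inside {z} {w} {z'} v z≤w w≤z' with z ≤? w | w ≤? z'
  ... | yes _    | yes _    = refl
  ... | no  z≰w  | _        = ⊥-elim (z≰w z≤w)
  ... | yes _    | no  w≰z' = ⊥-elim (w≰z' w≤z')

  gate-zero : ∀ {z w z'} {v : ℤ} → (z ≤ w → w ≤ z' → v ≡ + 0) → gate z w z' v ≡ + 0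
  gate-zero {z} {w} {z'} v≡0 with z ≤? w | w ≤? z'
  ... | yes z≤w | yes w≤z' = v≡0 z≤w w≤z'
  ... | yes _   | no  _    = refl
  ... | no  _   | _        = refl

  ·-zero : ∀ {p q : IFun} {z z'} →
           (∀ w → z ≤ w → w ≤ z' → (p z w *P q w z') ≈P 0P) → (p · q) z z' ≈P 0P
  ·-zero pq≈0 k = sumFin-zero size (λ w → gate-zero (λ z≤w w≤z' → pq≈0 w z≤w w≤z' k))

  ·-supported-at : ∀ {p q : IFun} {z z'} w₀ → z ≤ w₀ → w₀ ≤ z' →
                   (∀ w → w ≢ w₀ → p z w ≈P 0P) → (p · q) z z' ≈P (p z w₀ *P q w₀ z')
  ·-supported-at {p} {q} {z} {z'} w₀ z≤w₀ w₀≤z' p≈0 k =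
    trans (sumFin-supported-at size w₀
            (λ w w≢w₀ → gate-zero (λ _ _ → *P-zeroˡ (q w z') (p≈0 w w≢w₀) k)))
          (gate-inside _ z≤w₀ w₀≤z')

  rev-cong : ∀ r {p q : IFun} {z z'} → p z z' ≈P q z z' → rev r p z z' ≈P rev r q z z'
  rev-cong r {z = z} {z'} p≈q k with k ℕ.≤? r z z'
  ... | yes _ = p≈q (r z z' ∸ k)
  ... | no  _ = refl

  rev-zero : ∀ r {p : IFun} {z z'} → p z z' ≈P 0P → rev r p z z' ≈P 0P
  rev-zero r {z = z} {z'} p≈0 k with k ℕ.≤? r z z'
  ... | yes _ = p≈0 (r z z' ∸ k)
  ... | no  _ = refl

module GammaProperties (X Y : FinOrd) (σ : Fin (FinOrd.size X) → Fin (FinOrd.size Y)) where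
  private
    module X = FinOrd X
    module Y = FinOrd Y
  open Subdivision X Y
  open Incidence (Γ σ)
  open IncidenceProperties (Γ σ)
  open FinOrd (Γ σ) using () renaming (_≤_ to _≤Γ_)

  ι₁ : Fin X.size → Elt
  ι₁ x = x ↑ˡ Y.size

  ι₂ : Fin Y.size → Elt
  ι₂ y = X.size ↑ʳ y

  splitAt-ι₁ : ∀ x → splitAt X.size (ι₁ x) ≡ inj₁ x
  splitAt-ι₁ x = FinP.splitAt-↑ˡ X.size x Y.size

  splitAt-ι₂ : ∀ y → splitAt X.size (ι₂ y) ≡ inj₂ y
  splitAt-ι₂ y = FinP.splitAt-↑ʳ X.size Y.size y

  ≤Γ⇒ΓRel : ∀ {a b u v} → splitAt X.size a ≡ u → splitAt X.size b ≡ v → a ≤Γ b → ΓRel σ u v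
  ≤Γ⇒ΓRel refl refl a≤b = a≤b

  ΓRel⇒≤Γ : ∀ {a b u v} → splitAt X.size a ≡ u → splitAt X.size b ≡ v → ΓRel σ u v → a ≤Γ b
  ΓRel⇒≤Γ refl refl u≤v = u≤v

  InX/Y : Elt → Elt → Set
  InX/Y a b = ∃₂ λ x y → splitAt X.size a ≡ inj₁ x × splitAt X.size b ≡ inj₂ y

  InX/Y° : Elt → Elt → Set
  InX/Y° a b = ∃ λ x → splitAt X.size a ≡ inj₁ x × splitAt X.size b ≡ inj₂ (σ x)

  inX/Y? : ∀ a b → Dec (InX/Y a b)
  inX/Y? a b with splitAt X.size a | splitAt X.size b
  ... | inj₁ x | inj₂ y = yes (x , y , refl , refl)
  ... | inj₁ _ | inj₁ _ = no λ { (_ , _ , _ , ()) }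
  ... | inj₂ _ | _      = no λ { (_ , _ , () , _) }

  inX/Y°-target : ∀ {a b x} → splitAt X.size a ≡ inj₁ x → InX/Y° a b →
                  splitAt X.size b ≡ inj₂ (σ x)
  inX/Y°-target ea (x' , ea' , eb) =
    subst (λ x → _ ≡ inj₂ (σ x)) (inj₁-injective (trans (sym ea') ea)) eb

  ¬inX/Y°-ι₂ : ∀ {y b} → ¬ InX/Y° (ι₂ y) b
  ¬inX/Y°-ι₂ {y} (_ , e , _) = inj₁≢inj₂ (trans (sym e) (splitAt-ι₂ y))

  ΓRel-from-Y : ∀ {y v} → ΓRel σ (inj₂ y) v → ∃ λ y' → v ≡ inj₂ y'
  ΓRel-from-Y {v = inj₂ y'} _ = y' , refl

  ΓRel-to-X : ∀ {u x} → ΓRel σ u (inj₁ x) → ∃ λ x' → u ≡ inj₁ x'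
  ΓRel-to-X {u = inj₁ x'} _ = x' , refl

  inX/Y°-≤⇒inX/Y : ∀ {a w b} → InX/Y° a w → w ≤Γ b → InX/Y a b
  inX/Y°-≤⇒inX/Y (x , ea , ew) w≤b with ΓRel-from-Y (≤Γ⇒ΓRel ew refl w≤b)
  ... | y , eb = x , y , ea , eb

  ≤-inX/Y°⇒inX/Y : ∀ {a w b} → a ≤Γ w → InX/Y° w b → InX/Y a b
  ≤-inX/Y°⇒inX/Y a≤w (x , ew , eb) with ΓRel-to-X (≤Γ⇒ΓRel refl ew a≤w)
  ... | x' , ea = x' , σ x , ea , eb

  module _ (κ : IFun) where

    resXY-in : ∀ {a b} → InX/Y a b → resXY κ a b ≈P κ a b
    resXY-in (_ , _ , ea , eb) k rewrite ea | eb = refl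

    resXY-out : ∀ {a b} → ¬ InX/Y a b → resXY κ a b ≈P 0P
    resXY-out {a} {b} ∉X/Y k with splitAt X.size a | splitAt X.size b
    ... | inj₁ x | inj₂ y = ⊥-elim (∉X/Y (x , y , refl , refl))
    ... | inj₁ _ | inj₁ _ = refl
    ... | inj₂ _ | inj₁ _ = refl
    ... | inj₂ _ | inj₂ _ = refl

    resXY°-in : ∀ {a b} → InX/Y° a b → resXY° σ κ a b ≈P κ a b
    resXY°-in (x , ea , eb) k rewrite ea | eb with σ x FinP.≟ σ x
    ... | yes _     = refl
    ... | no  σx≢σx = ⊥-elim (σx≢σx refl)

    resXY°-out : ∀ {a b} → ¬ InX/Y° a b → resXY° σ κ a b ≈P 0P
    resXY°-out {a} {b} ∉X/Y° k with splitAt X.size a | splitAt X.size b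
    ... | inj₁ x | inj₂ y with σ x FinP.≟ y
    ...   | yes refl = ⊥-elim (∉X/Y° (x , refl , refl))
    ...   | no  _    = refl
    resXY°-out ∉X/Y° k | inj₁ _ | inj₁ _ = refl
    resXY°-out ∉X/Y° k | inj₂ _ | inj₁ _ = refl
    resXY°-out ∉X/Y° k | inj₂ _ | inj₂ _ = refl

  inX/Y°⇒≤Γ : Reflexive Y._≤_ → ∀ {a b} → InX/Y° a b → a ≤Γ b
  inX/Y°⇒≤Γ Y-refl (_ , ea , eb) = ΓRel⇒≤Γ ea eb Y-refl

  module _ (Y-refl : Reflexive Y._≤_) (κ : IFun) (mult : Multiplicative κ) where

    resXY≈resXY°·κ : resXY κ ≈I (resXY° σ κ · κ)
    resXY≈resXY°·κ a b a≤b with inX/Y? a b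
    ... | no ∉X/Y = begin
      resXY κ a b          ≈⟨ resXY-out κ ∉X/Y ⟩
      0P                   ≈⟨ ·-zero {resXY° σ κ} {κ} vanish ⟨
      (resXY° σ κ · κ) a b ∎
      where
      open PolyReasoning
      vanish : ∀ w → a ≤Γ w → w ≤Γ b → (resXY° σ κ a w *P κ w b) ≈P 0P
      vanish w _ w≤b =
        *P-zeroˡ (κ w b) (resXY°-out κ λ over → ∉X/Y (inX/Y°-≤⇒inX/Y over w≤b))
    ... | yes (x , y , ea , eb) = begin
      resXY κ a b               ≈⟨ resXY-in κ (x , y , ea , eb) ⟩
      κ a b                     ≈⟨ mult a w₀ b a≤w₀ w₀≤b ⟩
      κ a w₀ *P κ w₀ b          ≈⟨ *P-congˡ (κ w₀ b) (resXY°-in κ over) ⟨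
      resXY° σ κ a w₀ *P κ w₀ b ≈⟨ ·-supported-at {resXY° σ κ} {κ} w₀ a≤w₀ w₀≤b off-w₀ ⟨
      (resXY° σ κ · κ) a b      ∎
      where
      open PolyReasoning
      w₀ = ι₂ (σ x)
      over : InX/Y° a w₀
      over = x , ea , splitAt-ι₂ (σ x)
      a≤w₀ : a ≤Γ w₀
      a≤w₀ = inX/Y°⇒≤Γ Y-refl over
      w₀≤b : w₀ ≤Γ b
      w₀≤b = ΓRel⇒≤Γ (splitAt-ι₂ (σ x)) eb (≤Γ⇒ΓRel ea eb a≤b)
      off-w₀ : ∀ w → w ≢ w₀ → resXY° σ κ a w ≈P 0P
      off-w₀ w w≢w₀ = resXY°-out κ λ over′ →
        w≢w₀ (sym (FinP.splitAt⁻¹-↑ʳ (inX/Y°-target ea over′)))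

    module _ {ρX : Fin X.size → ℕ} {ρY : Fin Y.size → ℕ}
             (subdivision : StrongFormalSubdivision ρX ρY σ)
             (r : Elt → Elt → ℕ) (alternating : RankAlternating r (ρΓ ρX ρY) κ) where
      open StrongFormalSubdivision subdivision using (rankIneq; fiberSum)

      sign-ρΓ-over : ∀ {w b x'} →
                     splitAt X.size w ≡ inj₁ x' → splitAt X.size b ≡ inj₂ (σ x') →
                     sign (ρΓ ρX ρY b ∸ ρΓ ρX ρY w) ≡ - sign (ρY (σ x') ∸ ρX x')
      sign-ρΓ-over ew eb rewrite ew | eb = sign-suc-∸ (rankIneq _)

      rev-resXY°-in : ∀ {w b} → InX/Y° w b →
                      rev r (resXY° σ κ) w b ≈P scaleP (sign (ρΓ ρX ρY b ∸ ρΓ ρX ρY w)) (κ w b)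
      rev-resXY°-in {w} {b} over k =
        trans (rev-cong r {resXY° σ κ} {κ} (resXY°-in κ over) k)
              (alternating w b (inX/Y°⇒≤Γ Y-refl over) k)

      fiber-term : ∀ {a b x y} → splitAt X.size a ≡ inj₁ x → splitAt X.size b ≡ inj₂ y →
                   ∀ k x' → gate a (ι₁ x') b ((κ a (ι₁ x') *P rev r (resXY° σ κ) (ι₁ x') b) k)
                            ≡ fiberGate σ x y x' (sign (ρY y ∸ ρX x')) ℤ.* (- κ a b k)
      fiber-term {a} {b} {x} {y} ea eb k x' with x X.≤? x' | σ x' FinP.≟ y
      ... | no x≰x' | _ =
        gate-zero λ a≤w _ → ⊥-elim (x≰x' (≤Γ⇒ΓRel ea (splitAt-ι₁ x') a≤w))
      ... | yes _ | no σx'≢y =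
        gate-zero λ _ _ → *P-zeroʳ (κ a (ι₁ x')) (rev-zero r (resXY°-out κ λ over →
          σx'≢y (inj₂-injective (trans (sym (inX/Y°-target (splitAt-ι₁ x') over)) eb)))) k
      ... | yes x≤x' | yes refl = begin
        gate a w b ((κ a w *P rev r (resXY° σ κ) w b) k) ≡⟨ gate-inside _ a≤w w≤b ⟩
        (κ a w *P rev r (resXY° σ κ) w b) k              ≡⟨ *P-congʳ (κ a w) (rev-resXY°-in over) k ⟩
        (κ a w *P scaleP s (κ w b)) k                    ≡⟨ *P-scaleʳ (κ a w) (κ w b) s k ⟩
        s ℤ.* (κ a w *P κ w b) k                         ≡⟨ cong₂ ℤ._*_ (sign-ρΓ-over (splitAt-ι₁ x') eb)
                                                                        (sym (mult a w b a≤w w≤b k)) ⟩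
        - t ℤ.* κ a b k                                  ≡⟨ ℤP.neg-distribˡ-* t (κ a b k) ⟨
        - (t ℤ.* κ a b k)                                ≡⟨ ℤP.neg-distribʳ-* t (κ a b k) ⟩
        t ℤ.* (- κ a b k)                                ∎
        where
        open ≡-Reasoning
        w = ι₁ x'
        over : InX/Y° w b
        over = x' , splitAt-ι₁ x' , eb
        a≤w : a ≤Γ w
        a≤w = ΓRel⇒≤Γ ea (splitAt-ι₁ x') x≤x'
        w≤b : w ≤Γ b
        w≤b = inX/Y°⇒≤Γ Y-refl over
        s = sign (ρΓ ρX ρY b ∸ ρΓ ρX ρY w)
        t = sign (ρY (σ x') ∸ ρX x')

      κ·rev-resXY°-in : ∀ {a b} → a ≤Γ b → InX/Y a b →
                        (κ · rev r (resXY° σ κ)) a b ≈P (-P κ a b)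
      κ·rev-resXY°-in {a} {b} a≤b (x , y , ea , eb) k = begin
        (κ · rev r (resXY° σ κ)) a b k
          ≡⟨ sumFin-split X.size Y.size term ⟩
        sumFin X.size (term ∘ ι₁) ℤ.+ sumFin Y.size (term ∘ ι₂)
          ≡⟨ cong₂ ℤ._+_ (sumFin-cong X.size (fiber-term ea eb k)) (sumFin-zero Y.size over-Y) ⟩
        sumFin X.size (λ x' → fiberSign x' ℤ.* (- κ a b k)) ℤ.+ + 0
          ≡⟨ ℤP.+-identityʳ _ ⟩
        sumFin X.size (λ x' → fiberSign x' ℤ.* (- κ a b k))
          ≡⟨ sumFin-*ʳ X.size fiberSign (- κ a b k) ⟩
        sumFin X.size fiberSign ℤ.* (- κ a b k)
          ≡⟨ cong (ℤ._* (- κ a b k)) (fiberSum x y (≤Γ⇒ΓRel ea eb a≤b)) ⟩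
        + 1 ℤ.* (- κ a b k)
          ≡⟨ ℤP.*-identityˡ (- κ a b k) ⟩
        - κ a b k
          ∎
        where
        open ≡-Reasoning
        term : Elt → ℤ
        term w = gate a w b ((κ a w *P rev r (resXY° σ κ) w b) k)
        fiberSign : Fin X.size → ℤ
        fiberSign x' = fiberGate σ x y x' (sign (ρY y ∸ ρX x'))
        over-Y : ∀ y' → term (ι₂ y') ≡ + 0
        over-Y y' = gate-zero λ _ _ →
          *P-zeroʳ (κ a (ι₂ y')) (rev-zero r (resXY°-out κ ¬inX/Y°-ι₂)) k

      resXY≈-κ·rev-resXY° : resXY κ ≈I (-I (κ · rev r (resXY° σ κ)))
      resXY≈-κ·rev-resXY° a b a≤b k with inX/Y? a b
      ... | no ∉X/Y = begin
        resXY κ a b k                       ≡⟨ resXY-out κ ∉X/Y k ⟩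
        + 0                                 ≡⟨ cong -_ (·-zero {κ} {rev r (resXY° σ κ)} vanish k) ⟨
        - (κ · rev r (resXY° σ κ)) a b k    ∎
        where
        open ≡-Reasoning
        vanish : ∀ w → a ≤Γ w → w ≤Γ b → (κ a w *P rev r (resXY° σ κ) w b) ≈P 0P
        vanish w a≤w _ = *P-zeroʳ (κ a w)
          (rev-zero r (resXY°-out κ λ over → ∉X/Y (≤-inX/Y°⇒inX/Y a≤w over)))
      ... | yes inX/Y = begin
        resXY κ a b k                       ≡⟨ resXY-in κ inX/Y k ⟩
        κ a b k                             ≡⟨ ℤP.neg-involutive _ ⟨
        - - κ a b k                         ≡⟨ cong -_ (κ·rev-resXY°-in a≤b inX/Y k) ⟨
        - (κ · rev r (resXY° σ κ)) a b k    ∎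
        where open ≡-Reasoning

lemma3p22 : (X Y : FinOrd)
    (ρX : Fin (FinOrd.size X) → ℕ) (ρY : Fin (FinOrd.size Y) → ℕ)
    (σ : Fin (FinOrd.size X) → Fin (FinOrd.size Y)) →
    LowerEulerian X ρX → LowerEulerian Y ρY →
    Subdivision.StrongFormalSubdivision X Y ρX ρY σ →
    (r : Incidence.Elt (Subdivision.Γ X Y σ) → Incidence.Elt (Subdivision.Γ X Y σ) → ℕ) →
    Incidence.IsWeakRank (Subdivision.Γ X Y σ) r →
    (κ : Incidence.IFun (Subdivision.Γ X Y σ)) →
    Incidence.InCalI (Subdivision.Γ X Y σ) r κ →
    Incidence.InU (Subdivision.Γ X Y σ) κ →
    Incidence.Multiplicative (Subdivision.Γ X Y σ) κ →
    Incidence.RankAlternating (Subdivision.Γ X Y σ) r (Subdivision.ρΓ X Y ρX ρY) κ →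
    Incidence._≈I_ (Subdivision.Γ X Y σ) (Subdivision.resXY X Y κ)
      (Incidence._·_ (Subdivision.Γ X Y σ) (Subdivision.resXY° X Y σ κ) κ)
    × Incidence._≈I_ (Subdivision.Γ X Y σ) (Subdivision.resXY X Y κ)
      (Incidence.-I_ (Subdivision.Γ X Y σ)
        (Incidence._·_ (Subdivision.Γ X Y σ) κ
          (Incidence.rev (Subdivision.Γ X Y σ) r (Subdivision.resXY° X Y σ κ))))
lemma3p22 X Y ρX ρY σ _ eulerianY subdivision r _ κ _ _ mult alternating =
  resXY≈resXY°·κ Y-refl κ mult ,
  resXY≈-κ·rev-resXY° Y-refl κ mult subdivision r alternating
  where
  open GammaProperties X Y σ
  Y-refl : Reflexive (FinOrd._≤_ Y)
  Y-refl = IsPartialOrder.refl (LowerEulerian.isPartialOrder eulerianY)
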